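{- Let $\gamma\in\mathrm{Clan}_{p,q}$ and let $\ell$ be the degree of $F_\gamma$. Then the coefficient of $x_1x_2\cdots x_\ell$ in $F_\gamma$ is $\#\mathcal R(\gamma)$.
   Context: Fix integers $p,q\ge0$, $n=p+q$, $[n]=\{1,\dots,n\}$. A $(p,q)$-clan is an involution $\gamma$ of $[n]$ each of whose fixed points is labelled $+$ or $-$, with (number of $+$) $-$ (number of $-$) $=p-q$; $\mathrm{Clan}_{p,q}$ is the set of these, $\iota(\gamma)$ the underlying involution, and $i\neq j$ are matched if $\iota(\gamma)(i)=j$. Let $s_i=(i\;i{+}1)$ and $\ell(w)$ the number of inversions of a permutation $w$. For $1\le i<n$, $s_i\gamma s_i$ is the clan with underlying involution $s_i\iota(\gamma)s_i$, fixed points keeping their signs except that the signs of $i,i+1$ (when fixed) become those of $i+1,i$ in $\gamma$. The partial operation $\gamma\ast s_i$: if $i,i+1$ are fixed points of opposite sign, $\gamma\ast s_i$ is $\gamma$ with $i,i+1$ matched; if $i,i+1$ are matched to each other or fixed of equal sign, undefined; otherwise $\gamma\ast s_i=s_i\gamma s_i$. With $m=\min(p,q)$, $\gamma_{p,q}$ has underlying involution $(1\;n)(2\;n{ - }1)\cdots(m\;n{ - }m{+}1)$ and all remaining fixed points of the sign of $p-q$. A word $a_1\cdots a_\ell$ is a reduced word for $\gamma$ if there are clans $\gamma_{p,q}=\delta_0,\dots,\delta_\ell=\gamma$ with $\delta_j\ast s_{a_j}$ defined, equal to $\delta_{j-1}$, and $\ell(\iota(\delta_{j-1}))>\ell(\iota(\delta_j))$;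 $\mathcal R(\gamma)$ is the set of them. For a word $a=a_1\cdots a_\ell$, a compatible sequence is a word $b_1\cdots b_\ell$ with $1\le b_1\le\cdots\le b_\ell$, $b_i\le a_i$, and $b_i<b_{i+1}$ whenever $a_i<a_{i+1}$; $\mathrm{comp}(a)$ is their set. $\mathfrak S_\gamma=\sum_{a\in\mathcal R(\gamma)}\sum_{b\in\mathrm{comp}(a)}x_{b_1}\cdots x_{b_\ell}$; $\gamma^{+1}\in\mathrm{Clan}_{p+1,q+1}$ is obtained by shifting $\gamma$ to $\{2,\dots,n+1\}$ (keeping signs) and matching $1$ with $n+2$; $\gamma^{+m}=(\gamma^{+(m-1)})^{+1}$; and $F_\gamma=\lim_{m\to\infty}\mathfrak S_{\gamma^{+m}}$, a homogeneous symmetric function. -}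

module Defs where

open import Data.Bool using (Bool; true; false; if_then_else_; _∧_; _xor_)
open import Data.Nat using (ℕ; zero; suc; _+_; _∸_; _≤_; _<_; _⊓_; _≡ᵇ_; _<ᵇ_; _≤ᵇ_)
open import Data.List using (List; []; _∷_; _++_; map; length; upTo; reverse)
open import Data.Nat.ListAction using (sum)
open import Data.List.Membership.Propositional using (_∈_)
open import Data.List.Relation.Unary.Unique.Propositional using (Unique)
open import Data.Maybe using (Maybe; just; nothing)
open import Data.Product using (Σ; ∃; _×_)
open import Data.Unit using (⊤)
open import Data.Empty using (⊥)
open import Function.Bundles using (_⇔_)
open import Relation.Binary.PropositionalEquality using (_≡_; _≢_)

-- A clan on [n] = {1,…,n} is stored as the list of its
-- entries at positions 1,…,n (list index k-1 holds position k).
-- An entry is either a fixed point with a sign (true = +, false = −)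
-- or "mate j" meaning the position is matched with j (1-based).

data Entry : Set where
  sgn  : Bool → Entry
  mate : ℕ → Entry

Raw : Set
Raw = List Entry

at : Raw → ℕ → Maybe Entry
at xs zero = nothing
at [] (suc k) = nothing
at (x ∷ xs) (suc zero) = just x
at (x ∷ xs) (suc (suc k)) = at xs (suc k)

countSign : Bool → Raw → ℕ
countSign b [] = 0
countSign b (sgn true ∷ xs) = (if b then 1 else 0) + countSign b xs
countSign b (sgn false ∷ xs) = (if b then 0 else 1) + countSign b xs
countSign b (mate _ ∷ xs) = countSign b xs

IsClan : ℕ → ℕ → Raw → Set
IsClan p q δ =
  (length δ ≡ p + q)
  × (∀ k j → at δ k ≡ just (mate j) → (j ≢ k) × (at δ j ≡ just (mate k)))
  × (countSign true δ + q ≡ countSign false δ + p)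

Clan : ℕ → ℕ → Set
Clan p q = Σ Raw (IsClan p q)

positions : Raw → List ℕ
positions δ = map suc (upTo (length δ))

sw : ℕ → ℕ → ℕ
sw i k = if k ≡ᵇ i then suc i else (if k ≡ᵇ suc i then i else k)

entryAt : Raw → ℕ → Entry
entryAt δ k with at δ k
... | just e = e
... | nothing = sgn true   -- never used for k ∈ [n]

conj : ℕ → Raw → Raw
conj i δ = map f (positions δ)
  where
  f : ℕ → Entry
  f k with entryAt δ (sw i k)
  ... | sgn s = sgn s
  ... | mate j = mate (sw i j)

matchPair : ℕ → Raw → Raw
matchPair i δ = map f (positions δ)
  where
  f : ℕ → Entry
  f k = if k ≡ᵇ i then mate (suc i) else (if k ≡ᵇ suc i then mate i else entryAt δ k)

star : ℕ → Raw → Maybe Raw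
star i δ = if (1 ≤ᵇ i) ∧ (i <ᵇ length δ) then go (at δ i) (at δ (suc i)) else nothing
  where
  go : Maybe Entry → Maybe Entry → Maybe Raw
  go (just (sgn s)) (just (sgn t)) = if s xor t then just (matchPair i δ) else nothing
  go (just (mate j)) _ = if j ≡ᵇ suc i then nothing else just (conj i δ)
  go _ _ = just (conj i δ)

invol : Raw → ℕ → ℕ
invol δ k with at δ k
... | just (mate j) = j
... | _ = k

inv : Raw → ℕ
inv δ = sum (map (λ k → sum (map (λ l → if (k <ᵇ l) ∧ (invol δ l <ᵇ invol δ k) then 1 else 0)
                                 (positions δ)))
                 (positions δ))

gpq : ℕ → ℕ → Raw
gpq p q = map f (map suc (upTo (p + q)))
  where
  n = p + q
  m = p ⊓ q
  f : ℕ → Entry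
  f k = if k ≤ᵇ m then mate (suc n ∸ k)
        else (if (n ∸ m) <ᵇ k then mate (suc n ∸ k) else sgn (q <ᵇ p))

-- reduced words, checked backwards: the word is given reversed
-- (a_ℓ, a_{ℓ-1}, …, a_1), starting from δ_ℓ = γ.
RedRev : ℕ → ℕ → Raw → List ℕ → Set
RedRev p q δ [] = δ ≡ gpq p q
RedRev p q δ (x ∷ xs) =
  Σ Raw λ δ' → (star x δ ≡ just δ') × (inv δ < inv δ') × RedRev p q δ' xs

Red : ℕ → ℕ → Raw → List ℕ → Set
Red p q δ a = RedRev p q δ (reverse a)

Step : ℕ → ℕ → List ℕ → List ℕ → Set
Step a b [] [] = ⊤
Step a b (a' ∷ _) (b' ∷ _) = (b ≤ b') × (a < a' → b < b')
Step a b _ _ = ⊥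

Comp : List ℕ → List ℕ → Set
Comp [] [] = ⊤
Comp (a ∷ as) (b ∷ bs) = (1 ≤ b) × (b ≤ a) × Step a b as bs × Comp as bs
Comp _ _ = ⊥

Enumerates : List (List ℕ) → (List ℕ → Set) → Set
Enumerates L P = Unique L × (∀ a → (a ∈ L) ⇔ P a)

HasCard : (List ℕ → Set) → ℕ → Set
HasCard P c = Σ (List (List ℕ)) λ L → Enumerates L P × (length L ≡ c)

-- Coefficient of the monomial x_{μ_1}⋯x_{μ_k} (μ weakly increasing) in 𝔖_γ
-- is c: the number of pairs (a,b), a ∈ 𝓡(γ), b ∈ comp(a), with b = μ.
CoefS : ℕ → ℕ → Raw → List ℕ → ℕ → Set
CoefS p q δ μ c = HasCard (λ a → Red p q δ a × Comp a μ) c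

bump : Entry → Entry
bump (sgn s) = sgn s
bump (mate j) = mate (suc j)

shift1 : Raw → Raw
shift1 δ = mate (length δ + 2) ∷ map bump δ ++ (mate 1 ∷ [])

shiftN : ℕ → Raw → Raw
shiftN zero δ = δ
shiftN (suc m) δ = shift1 (shiftN m δ)

-- the coefficient of x_μ in F_γ = lim_m 𝔖_{γ^{+m}} is c
CoefF : ℕ → ℕ → Raw → List ℕ → ℕ → Set
CoefF p q δ μ c = ∃ λ M → ∀ m → M ≤ m → CoefS (p + m) (q + m) (shiftN m δ) μ c

FDegree : ℕ → ℕ → Raw → ℕ → Set
FDegree p q δ ℓ =
  (Σ (List ℕ) λ μ → Σ ℕ λ c → (c ≢ 0) × CoefF p q δ μ c)
  × (∀ μ c → CoefF p q δ μ c → c ≢ 0 → length μ ≡ ℓ)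

module Submission where

-- Core: a SHIFT LEMMA, the
-- reduced words of γ^{+1} are exactly 1 + a (add 1 to every letter) for
-- a ∈ 𝓡(γ).  It rests on four facts about the shift γ ↦ γ^{+1}:
--   * it commutes with ∗:  γ^{+1} ∗ s_{i+1} = (γ ∗ s_i)^{+1};
--   * it adds 2n+1 to the length of the underlying involution;
--   * γ_{p+1,q+1} = (γ_{p,q})^{+1}, and the shift is injective;
--   * s₁ and s_{n+1} cannot lengthen ι(γ^{+1}), so the boundary letters
--     1 and n+1 never occur in its reduced words.
-- Iterating, 𝓡(γ^{+m}) = m + 𝓡(γ).  𝓡(γ) is finite (bounded search), and
-- for m ≥ k every shifted word m + a of length k has 1,2,…,k as compatible
-- sequence, so the coefficient of x₁⋯x_k in 𝔖_{γ^{+m}} is the number of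
-- words of 𝓡(γ) of length k.  The degree hypothesis forces all of them to
-- have length ℓ.

open import Defs
open import Data.Bool using (Bool; true; false; if_then_else_; _xor_; _∧_)
open import Data.Bool.Properties using (T-≡) renaming (_≟_ to _≟𝔹_)
open import Data.Nat
open import Data.Nat.Properties
open import Data.Nat.ListAction using (sum)
open import Data.Nat.Tactic.RingSolver using (solve-∀)
open import Data.List using (List; []; _∷_; _++_; map; length; upTo; applyUpTo; reverse; filter; concatMap; deduplicate)
open import Data.List.Properties
open import Data.List.Membership.Propositional using (_∈_)
open import Data.List.Membership.Propositional.Properties
  using (∈-++⁺ˡ; ∈-++⁺ʳ; ∈-++⁻; ∈-map⁺; ∈-map⁻; ∈-filter⁺; ∈-filter⁻; ∈-concat⁺′; ∈-concat⁻′; ∈-upTo⁺)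
open import Data.List.Membership.Setoid.Properties using (∈-deduplicate⁺; ∈-deduplicate⁻)
open import Data.List.Relation.Unary.Any using (here)
import Data.List.Relation.Unary.All as All
import Data.List.Relation.Unary.Unique.Propositional.Properties as Unique
import Data.List.Relation.Unary.Unique.DecPropositional.Properties as DecUnique
open import Data.Maybe using (Maybe; just; nothing) renaming (map to mmap)
open import Data.Product using (Σ; _×_; _,_; proj₁; proj₂; uncurry)
open import Data.Sum using (inj₁; inj₂)
open import Data.Unit using (tt)
open import Data.Empty using (⊥-elim)
open import Relation.Nullary using (yes; no)
open import Relation.Binary.Definitions using (DecidableEquality; tri<; tri≈; tri>)
open import Relation.Binary.PropositionalEquality
open import Function using (_∘_; id; _∋_)
open import Function.Bundles using (mk⇔; Equivalence)

<ᵇ-true : ∀ {a b} → a < b → (a <ᵇ b) ≡ true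
<ᵇ-true a<b = Equivalence.to T-≡ (<⇒<ᵇ a<b)

<ᵇ-false : ∀ {a b} → b ≤ a → (a <ᵇ b) ≡ false
<ᵇ-false {a} {zero} _ = refl
<ᵇ-false {suc a} {suc b} (s≤s b≤a) = <ᵇ-false b≤a

≡ᵇ-refl : ∀ a → (a ≡ᵇ a) ≡ true
≡ᵇ-refl a = Equivalence.to T-≡ (≡⇒≡ᵇ a a refl)

≡ᵇ-false : ∀ {a b} → a ≢ b → (a ≡ᵇ b) ≡ false
≡ᵇ-false {zero} {zero} a≢b = ⊥-elim (a≢b refl)
≡ᵇ-false {zero} {suc b} _ = refl
≡ᵇ-false {suc a} {zero} _ = refl
≡ᵇ-false {suc a} {suc b} a≢b = ≡ᵇ-false (a≢b ∘ cong suc)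

sw-left : ∀ i → sw i i ≡ suc i
sw-left i rewrite ≡ᵇ-refl i = refl

sw-right : ∀ i → sw i (suc i) ≡ i
sw-right i rewrite ≡ᵇ-false {suc i} {i} 1+n≢n | ≡ᵇ-refl i = refl

sw-other : ∀ {i k} → k ≢ i → k ≢ suc i → sw i k ≡ k
sw-other k≢i k≢1+i rewrite ≡ᵇ-false k≢i | ≡ᵇ-false k≢1+i = refl

data SwCase (i k : ℕ) : Set where
  at-i    : k ≡ i → SwCase i k
  at-1+i  : k ≡ suc i → SwCase i k
  outside : k ≢ i → k ≢ suc i → SwCase i k

swCase : ∀ i k → SwCase i k
swCase i k with k ≟ i | k ≟ suc i
... | yes k≡i | _ = at-i k≡i
... | no _ | yes k≡1+i = at-1+i k≡1+i
... | no k≢i | no k≢1+i = outside k≢i k≢1+i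

sw-involutive : ∀ i k → sw i (sw i k) ≡ k
sw-involutive i k with swCase i k
... | at-i refl rewrite sw-left i = sw-right i
... | at-1+i refl rewrite sw-right i = sw-left i
... | outside k≢i k≢1+i rewrite sw-other k≢i k≢1+i = sw-other k≢i k≢1+i

sw-suc : ∀ i k → sw (suc i) (suc k) ≡ suc (sw i k)
sw-suc i k with swCase i k
... | at-i refl rewrite sw-left i | sw-left (suc i) = refl
... | at-1+i refl rewrite sw-right i | sw-right (suc i) = refl
... | outside k≢i k≢1+i rewrite sw-other k≢i k≢1+i
  = sw-other (k≢i ∘ suc-injective) (k≢1+i ∘ suc-injective)

sw-range : ∀ {i k n} → 1 ≤ i → i < n → 1 ≤ k → k ≤ n → (1 ≤ sw i k) × (sw i k ≤ n)
sw-range {i} {k} 1≤i i<n 1≤k k≤n with swCase i k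
... | at-i refl rewrite sw-left i = s≤s z≤n , i<n
... | at-1+i refl rewrite sw-right i = 1≤i , ≤-trans (n≤1+n i) k≤n
... | outside k≢i k≢1+i rewrite sw-other k≢i k≢1+i = 1≤k , k≤n

at-tabulated : ∀ (f : ℕ → Entry) (g : ℕ → ℕ) n k → k < n →
               at (map f (map suc (applyUpTo g n))) (suc k) ≡ just (f (suc (g k)))
at-tabulated f g (suc n) zero _ = refl
at-tabulated f g (suc n) (suc k) (s≤s k<n) = at-tabulated f (g ∘ suc) n k k<n

at-positions : ∀ (f : ℕ → Entry) δ k → k < length δ → at (map f (positions δ)) (suc k) ≡ just (f (suc k))
at-positions f δ k = at-tabulated f id (length δ) k

length-positions : ∀ (f : ℕ → Entry) δ → length (map f (positions δ)) ≡ length δ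
length-positions f δ = begin
  length (map f (positions δ))       ≡⟨ length-map f (positions δ) ⟩
  length (map suc (upTo (length δ))) ≡⟨ length-map suc (upTo (length δ)) ⟩
  length (upTo (length δ))           ≡⟨ length-upTo (length δ) ⟩
  length δ                           ∎
  where open ≡-Reasoning

at-range : ∀ (xs : Raw) k {e} → at xs k ≡ just e → (1 ≤ k) × (k ≤ length xs)
at-range (x ∷ xs) (suc zero) _ = s≤s z≤n , s≤s z≤n
at-range (x ∷ xs) (suc (suc k)) eq = s≤s z≤n , s≤s (proj₂ (at-range xs (suc k) eq))

at-inside : ∀ (xs : Raw) k → k < length xs → Σ Entry λ e → at xs (suc k) ≡ just e
at-inside (x ∷ xs) zero _ = x , refl
at-inside (x ∷ xs) (suc k) (s≤s p) = at-inside xs k p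

at-++ˡ : ∀ (xs ys : Raw) k → k < length xs → at (xs ++ ys) (suc k) ≡ at xs (suc k)
at-++ˡ (x ∷ xs) ys zero _ = refl
at-++ˡ (x ∷ xs) ys (suc k) (s≤s p) = at-++ˡ xs ys k p

at-++-next : ∀ (xs : Raw) y ys → at (xs ++ y ∷ ys) (suc (length xs)) ≡ just y
at-++-next [] y ys = refl
at-++-next (x ∷ xs) y ys = at-++-next xs y ys

at-map-bump : ∀ (xs : Raw) k → at (map bump xs) k ≡ mmap bump (at xs k)
at-map-bump xs zero = refl
at-map-bump [] (suc k) = refl
at-map-bump (x ∷ xs) (suc zero) = refl
at-map-bump (x ∷ xs) (suc (suc k)) = at-map-bump xs (suc k)

raw-ext : ∀ (xs ys : Raw) → length xs ≡ length ys →
          (∀ k → k < length xs → at xs (suc k) ≡ at ys (suc k)) → xs ≡ ys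
raw-ext [] [] _ _ = refl
raw-ext (x ∷ xs) (y ∷ ys) len same with same zero (s≤s z≤n)
... | refl = cong (x ∷_) (raw-ext xs ys (suc-injective len) (λ k p → same (suc k) (s≤s p)))

entryAt-just : ∀ δ k e → at δ k ≡ just e → entryAt δ k ≡ e
entryAt-just δ k e eq rewrite eq = refl

invol-mate : ∀ δ k j → at δ k ≡ just (mate j) → invol δ k ≡ j
invol-mate δ k j eq rewrite eq = refl

invol-sign : ∀ δ k s → at δ k ≡ just (sgn s) → invol δ k ≡ k
invol-sign δ k s eq rewrite eq = refl

-- The only consequence of being a clan that the shift lemma needs:
-- every mate lies in [n].  It is preserved by ∗ and by the shift.
MatesInRange : Raw → Set
MatesInRange δ = ∀ k j → at δ k ≡ just (mate j) → (1 ≤ j) × (j ≤ length δ)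

ι₀ : Raw → ℕ → ℕ
ι₀ δ k = invol δ (suc k)

ι₀-range : ∀ δ → MatesInRange δ → ∀ k → k < length δ → (1 ≤ ι₀ δ k) × (ι₀ δ k ≤ length δ)
ι₀-range δ inRange k k<n with at-inside δ k k<n
... | sgn s , eq rewrite invol-sign δ (suc k) s eq = s≤s z≤n , k<n
... | mate j , eq rewrite invol-mate δ (suc k) j eq = inRange (suc k) j eq

length-shift1 : ∀ δ → length (shift1 δ) ≡ suc (suc (length δ))
length-shift1 δ = cong suc (begin
  length (map bump δ ++ mate 1 ∷ [])    ≡⟨ length-++ (map bump δ) ⟩
  length (map bump δ) + 1              ≡⟨ cong (_+ 1) (length-map bump δ) ⟩
  length δ + 1                         ≡⟨ +-comm (length δ) 1 ⟩
  suc (length δ)                       ∎)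
  where open ≡-Reasoning

at-shift1-mid : ∀ δ k → k < length δ → at (shift1 δ) (suc (suc k)) ≡ mmap bump (at δ (suc k))
at-shift1-mid δ k k<n = trans (at-++ˡ (map bump δ) _ k (subst (k <_) (sym (length-map bump δ)) k<n))
                              (at-map-bump δ (suc k))

at-shift1-last : ∀ δ → at (shift1 δ) (suc (suc (length δ))) ≡ just (mate 1)
at-shift1-last δ = subst (λ z → at (map bump δ ++ mate 1 ∷ []) (suc z) ≡ just (mate 1))
                         (length-map bump δ) (at-++-next (map bump δ) (mate 1) [])

shift1-by-entries : ∀ n (Δ δ : Raw) → length δ ≡ n → length Δ ≡ suc (suc n) →
  at Δ 1 ≡ just (mate (n + 2)) →
  (∀ k → k < n → at Δ (suc (suc k)) ≡ mmap bump (at δ (suc k))) →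
  at Δ (suc (suc n)) ≡ just (mate 1) → Δ ≡ shift1 δ
shift1-by-entries n Δ δ refl len first mid last = raw-ext Δ (shift1 δ) (trans len (sym (length-shift1 δ))) same
  where
  same : ∀ k → k < length Δ → at Δ (suc k) ≡ at (shift1 δ) (suc k)
  same zero _ = first
  same (suc k) k<N with m≤n⇒m<n∨m≡n (≤-pred (≤-pred (subst (suc k <_) len k<N)))
  ... | inj₁ k<n = trans (mid k k<n) (sym (at-shift1-mid δ k k<n))
  ... | inj₂ refl = trans last (sym (at-shift1-last δ))

ι₀-shift1-mid : ∀ δ k → k < length δ → ι₀ (shift1 δ) (suc k) ≡ suc (ι₀ δ k)
ι₀-shift1-mid δ k k<n with at-inside δ k k<n
... | sgn s , eq rewrite invol-sign δ (suc k) s eq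
  = invol-sign (shift1 δ) (suc (suc k)) s (trans (at-shift1-mid δ k k<n) (cong (mmap bump) eq))
... | mate j , eq rewrite invol-mate δ (suc k) j eq
  = invol-mate (shift1 δ) (suc (suc k)) (suc j) (trans (at-shift1-mid δ k k<n) (cong (mmap bump) eq))

ι₀-shift1-last : ∀ δ → ι₀ (shift1 δ) (suc (length δ)) ≡ 1
ι₀-shift1-last δ = invol-mate (shift1 δ) (suc (suc (length δ))) 1 (at-shift1-last δ)

sumBelow : ℕ → (ℕ → ℕ) → ℕ
sumBelow zero f = 0
sumBelow (suc n) f = f 0 + sumBelow n (f ∘ suc)

𝟙 : Bool → ℕ
𝟙 b = if b then 1 else 0

𝟙≤1 : ∀ b → 𝟙 b ≤ 1
𝟙≤1 true = ≤-refl
𝟙≤1 false = z≤n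

sumBelow-cong : ∀ n {f g} → (∀ k → k < n → f k ≡ g k) → sumBelow n f ≡ sumBelow n g
sumBelow-cong zero _ = refl
sumBelow-cong (suc n) f≡g = cong₂ _+_ (f≡g 0 (s≤s z≤n)) (sumBelow-cong n (λ k p → f≡g (suc k) (s≤s p)))

sumBelow-+ : ∀ n f g → sumBelow n (λ k → f k + g k) ≡ sumBelow n f + sumBelow n g
sumBelow-+ zero f g = refl
sumBelow-+ (suc n) f g rewrite sumBelow-+ n (f ∘ suc) (g ∘ suc) = interchange (f 0) (g 0) _ _
  where
  interchange : ∀ a b c d → a + b + (c + d) ≡ a + c + (b + d)
  interchange = solve-∀

sumBelow-last : ∀ n f → sumBelow (suc n) f ≡ sumBelow n f + f n
sumBelow-last zero f = +-comm (f 0) 0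
sumBelow-last (suc n) f rewrite sumBelow-last n (f ∘ suc) = sym (+-assoc (f 0) _ (f (suc n)))

sumBelow-ones : ∀ n {f} → (∀ k → k < n → f k ≡ 1) → sumBelow n f ≡ n
sumBelow-ones zero _ = refl
sumBelow-ones (suc n) f≡1 rewrite f≡1 0 (s≤s z≤n) = cong suc (sumBelow-ones n (λ k p → f≡1 (suc k) (s≤s p)))

sumBelow-zeros : ∀ n {f} → (∀ k → k < n → f k ≡ 0) → sumBelow n f ≡ 0
sumBelow-zeros zero _ = refl
sumBelow-zeros (suc n) f≡0 rewrite f≡0 0 (s≤s z≤n) = sumBelow-zeros n (λ k p → f≡0 (suc k) (s≤s p))

sumBelow-𝟙 : ∀ n (b : ℕ → Bool) → sumBelow n (λ k → 𝟙 (b k)) ≤ n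
sumBelow-𝟙 zero b = z≤n
sumBelow-𝟙 (suc n) b = +-mono-≤ (𝟙≤1 (b 0)) (sumBelow-𝟙 n (b ∘ suc))

Inversions : ℕ → (ℕ → ℕ) → ℕ
Inversions n f = sumBelow n (λ k → sumBelow n (λ l → 𝟙 ((k <ᵇ l) ∧ (f l <ᵇ f k))))

Inversions-first : ∀ n f → Inversions (suc n) f ≡ sumBelow n (λ l → 𝟙 (f (suc l) <ᵇ f 0)) + Inversions n (f ∘ suc)
Inversions-first n f = refl

Inversions-last : ∀ n f → Inversions (suc n) f ≡ Inversions n f + sumBelow n (λ k → 𝟙 (f n <ᵇ f k))
Inversions-last n f = begin
    Inversions (suc n) f
  ≡⟨ sumBelow-last n row ⟩
    sumBelow n row + row n
  ≡⟨ cong (sumBelow n row +_) (sumBelow-zeros (suc n) (λ l l≤n → cong (λ b → 𝟙 (b ∧ (f l <ᵇ f n))) (<ᵇ-false (≤-pred l≤n)))) ⟩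
    sumBelow n row + 0
  ≡⟨ +-identityʳ _ ⟩
    sumBelow n row
  ≡⟨ sumBelow-cong n (λ k k<n → trans (sumBelow-last n (pair k)) (cong (λ b → sumBelow n (pair k) + 𝟙 (b ∧ (f n <ᵇ f k))) (<ᵇ-true k<n))) ⟩
    sumBelow n (λ k → sumBelow n (pair k) + 𝟙 (f n <ᵇ f k))
  ≡⟨ sumBelow-+ n (λ k → sumBelow n (pair k)) (λ k → 𝟙 (f n <ᵇ f k)) ⟩
    Inversions n f + sumBelow n (λ k → 𝟙 (f n <ᵇ f k))
  ∎
  where
  open ≡-Reasoning
  pair : ℕ → ℕ → ℕ
  pair k l = 𝟙 ((k <ᵇ l) ∧ (f l <ᵇ f k))
  row : ℕ → ℕ
  row k = sumBelow (suc n) (pair k)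

Inversions-cong : ∀ n {f g} → (∀ k l → k < n → l < n → (f l <ᵇ f k) ≡ (g l <ᵇ g k)) →
                  Inversions n f ≡ Inversions n g
Inversions-cong n same = sumBelow-cong n (λ k k<n → sumBelow-cong n (λ l l<n → cong (λ b → 𝟙 ((k <ᵇ l) ∧ b)) (same k l k<n l<n)))

sum-positions : ∀ (g : ℕ → ℕ) (h : ℕ → ℕ) n → sum (map g (map suc (applyUpTo h n))) ≡ sumBelow n (λ k → g (suc (h k)))
sum-positions g h zero = refl
sum-positions g h (suc n) = cong (g (suc (h 0)) +_) (sum-positions g (h ∘ suc) n)

inv-Inversions : ∀ δ → inv δ ≡ Inversions (length δ) (ι₀ δ)
inv-Inversions δ = trans (sum-positions row id n) (sumBelow-cong n (λ k _ → sum-positions (pair (suc k)) id n))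
  where
  n = length δ
  pair : ℕ → ℕ → ℕ
  pair k l = if (k <ᵇ l) ∧ (invol δ l <ᵇ invol δ k) then 1 else 0
  row : ℕ → ℕ
  row k = sum (map (pair k) (positions δ))

-- ℓ(ι(γ^{+1})) = ℓ(ι(γ)) + 2n + 1: the new value n+2 in front and the new
-- value 1 at the end are each inverted with everything else
inv-shift1 : ∀ δ → MatesInRange δ → inv (shift1 δ) ≡ suc (length δ) + (inv δ + length δ)
inv-shift1 δ inRange = begin
    inv (shift1 δ)
  ≡⟨ inv-Inversions (shift1 δ) ⟩
    Inversions (length (shift1 δ)) F
  ≡⟨ cong (λ z → Inversions z F) (length-shift1 δ) ⟩
    Inversions (suc (suc n)) F
  ≡⟨ Inversions-first (suc n) F ⟩
    sumBelow (suc n) (λ l → 𝟙 (F (suc l) <ᵇ F 0)) + Inversions (suc n) (F ∘ suc)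
  ≡⟨ cong₂ _+_ firstValueMax (Inversions-last n (F ∘ suc)) ⟩
    suc n + (Inversions n (F ∘ suc) + sumBelow n (λ k → 𝟙 (F (suc n) <ᵇ F (suc k))))
  ≡⟨ cong₂ (λ a b → suc n + (a + b)) middle lastValueMin ⟩
    suc n + (Inversions n (ι₀ δ) + n)
  ≡⟨ cong (λ z → suc n + (z + n)) (sym (inv-Inversions δ)) ⟩
    suc n + (inv δ + n)
  ∎
  where
  open ≡-Reasoning
  n = length δ
  F = ι₀ (shift1 δ)
  firstValueMax : sumBelow (suc n) (λ l → 𝟙 (F (suc l) <ᵇ F 0)) ≡ suc n
  firstValueMax = sumBelow-ones (suc n) below
    where
    below : ∀ l → l < suc n → 𝟙 (F (suc l) <ᵇ F 0) ≡ 1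
    below l l≤n with m≤n⇒m<n∨m≡n (≤-pred l≤n)
    ... | inj₁ l<n rewrite ι₀-shift1-mid δ l l<n
      = cong 𝟙 (<ᵇ-true (≤-trans (s≤s (s≤s (proj₂ (ι₀-range δ inRange l l<n)))) (≤-reflexive (+-comm 2 n))))
    ... | inj₂ refl rewrite ι₀-shift1-last δ = cong 𝟙 (<ᵇ-true (≤-trans (s≤s (s≤s z≤n)) (≤-reflexive (+-comm 2 n))))
  middle : Inversions n (F ∘ suc) ≡ Inversions n (ι₀ δ)
  middle = Inversions-cong n {F ∘ suc} {ι₀ δ} (λ k l k<n l<n → cong₂ _<ᵇ_ (ι₀-shift1-mid δ l l<n) (ι₀-shift1-mid δ k k<n))
  lastValueMin : sumBelow n (λ k → 𝟙 (F (suc n) <ᵇ F (suc k))) ≡ n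
  lastValueMin = sumBelow-ones n (λ k k<n → trans (cong₂ (λ a b → 𝟙 (a <ᵇ b)) (ι₀-shift1-last δ) (ι₀-shift1-mid δ k k<n))
                                                   (cong 𝟙 (<ᵇ-true (s≤s (proj₁ (ι₀-range δ inRange k k<n))))))

conjEntry : ℕ → Entry → Entry
conjEntry i (sgn s) = sgn s
conjEntry i (mate j) = mate (sw i j)

-- (the entry function of conj is local to its definition: it is inferred from
-- at-positions and reduced by the case analysis on the entry at s_i(k+1))
at-conj : ∀ i δ k → k < length δ → at (conj i δ) (suc k) ≡ just (conjEntry i (entryAt δ (sw i (suc k))))
at-conj i δ k k<n with at δ (sw i (suc k)) in eq
... | just (sgn s) rewrite (at (conj i δ) (suc k) ≡ _ ∋ at-positions _ δ k k<n) | eq = refl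
... | just (mate j) rewrite (at (conj i δ) (suc k) ≡ _ ∋ at-positions _ δ k k<n) | eq = refl
... | nothing rewrite (at (conj i δ) (suc k) ≡ _ ∋ at-positions _ δ k k<n) | eq = refl

length-conj : ∀ i δ → length (conj i δ) ≡ length δ
length-conj i δ = length-positions _ δ

at-within : ∀ (xs : Raw) k → 1 ≤ k → k ≤ length xs → Σ Entry λ e → at xs k ≡ just e
at-within xs (suc k) _ k<n = at-inside xs k k<n

ι₀-conj : ∀ i δ k → 1 ≤ i → i < length δ → k < length δ → ι₀ (conj i δ) k ≡ sw i (invol δ (sw i (suc k)))
ι₀-conj i δ k 1≤i i<n k<n with uncurry (at-within δ (sw i (suc k))) (sw-range 1≤i i<n (s≤s z≤n) k<n)
... | sgn s , eq rewrite invol-sign δ (sw i (suc k)) s eq | sw-involutive i (suc k)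
  = invol-sign (conj i δ) (suc k) s (trans (at-conj i δ k k<n) (cong (just ∘ conjEntry i) (entryAt-just δ (sw i (suc k)) _ eq)))
... | mate j , eq rewrite invol-mate δ (sw i (suc k)) j eq
  = invol-mate (conj i δ) (suc k) (sw i j) (trans (at-conj i δ k k<n) (cong (just ∘ conjEntry i) (entryAt-just δ (sw i (suc k)) _ eq)))

matchPairEntry : ℕ → Raw → ℕ → Entry
matchPairEntry i δ k = if k ≡ᵇ i then mate (suc i) else (if k ≡ᵇ suc i then mate i else entryAt δ k)

at-matchPair : ∀ i δ k → k < length δ → at (matchPair i δ) (suc k) ≡ just (matchPairEntry i δ (suc k))
at-matchPair i δ = at-positions (matchPairEntry i δ) δ

length-matchPair : ∀ i δ → length (matchPair i δ) ≡ length δ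
length-matchPair i δ = length-positions _ δ

matchPairEntry-i : ∀ i δ → matchPairEntry i δ i ≡ mate (suc i)
matchPairEntry-i i δ rewrite ≡ᵇ-refl i = refl

matchPairEntry-1+i : ∀ i δ → matchPairEntry i δ (suc i) ≡ mate i
matchPairEntry-1+i i δ rewrite ≡ᵇ-false {suc i} {i} 1+n≢n | ≡ᵇ-refl i = refl

matchPairEntry-other : ∀ i δ {k} → k ≢ i → k ≢ suc i → matchPairEntry i δ k ≡ entryAt δ k
matchPairEntry-other i δ k≢i k≢1+i rewrite ≡ᵇ-false k≢i | ≡ᵇ-false k≢1+i = refl

starCase : ℕ → Raw → Maybe Entry → Maybe Entry → Maybe Raw
starCase i δ (just (sgn s)) (just (sgn t)) = if s xor t then just (matchPair i δ) else nothing
starCase i δ (just (mate j)) _ = if j ≡ᵇ suc i then nothing else just (conj i δ)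
starCase i δ _ _ = just (conj i δ)

star-unfold : ∀ x δ → 1 ≤ x → x < length δ → star x δ ≡ starCase x δ (at δ x) (at δ (suc x))
star-unfold (suc x) δ _ x<n rewrite <ᵇ-true x<n with at δ (suc x) | at δ (suc (suc x))
... | nothing | _ = refl
... | just (mate j) | _ = refl
... | just (sgn s) | nothing = refl
... | just (sgn s) | just (mate j) = refl
... | just (sgn s) | just (sgn t) = refl

star-outside : ∀ x δ → length δ ≤ x → star x δ ≡ nothing
star-outside zero δ _ = refl
star-outside (suc x) δ n≤x rewrite <ᵇ-false n≤x = refl

data StarStep (x : ℕ) (δ δ' : Raw) : Set where
  byConj  : δ' ≡ conj x δ → StarStep x δ δ'
  byMatch : ∀ {s t} → at δ x ≡ just (sgn s) → at δ (suc x) ≡ just (sgn t) → δ' ≡ matchPair x δ → StarStep x δ δ'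

starCase-step : ∀ x δ a b δ' → at δ x ≡ a → at δ (suc x) ≡ b → starCase x δ a b ≡ just δ' → StarStep x δ δ'
starCase-step x δ nothing b δ' _ _ refl = byConj refl
starCase-step x δ (just (mate j)) b δ' _ _ h with j ≡ᵇ suc x
starCase-step x δ (just (mate j)) b δ' _ _ refl | false = byConj refl
starCase-step x δ (just (sgn s)) nothing δ' _ _ refl = byConj refl
starCase-step x δ (just (sgn s)) (just (mate j)) δ' _ _ refl = byConj refl
starCase-step x δ (just (sgn s)) (just (sgn t)) δ' _ _ h with s xor t
starCase-step x δ (just (sgn s)) (just (sgn t)) δ' ea eb refl | true = byMatch ea eb refl

star-step : ∀ x δ δ' → star x δ ≡ just δ' → (1 ≤ x) × (x < length δ) × StarStep x δ δ'
star-step zero δ δ' ()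
star-step (suc x) δ δ' h with suc x <? length δ
... | no x≮n with () ← trans (sym (star-outside (suc x) δ (≮⇒≥ x≮n))) h
... | yes x<n = s≤s z≤n , x<n , starCase-step (suc x) δ _ _ δ' refl refl (trans (sym (star-unfold (suc x) δ (s≤s z≤n) x<n)) h)

length-star : ∀ x δ δ' → star x δ ≡ just δ' → length δ' ≡ length δ
length-star x δ δ' h with star-step x δ δ' h
... | _ , _ , byConj refl = length-conj x δ
... | _ , _ , byMatch _ _ refl = length-matchPair x δ

MatesInRange-by-positions : ∀ Δ → (∀ k j → k < length Δ → at Δ (suc k) ≡ just (mate j) → (1 ≤ j) × (j ≤ length Δ)) →
  MatesInRange Δ
MatesInRange-by-positions Δ inPosition (suc k) j h = inPosition k j (proj₂ (at-range Δ (suc k) h)) h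

MatesInRange-conj : ∀ i δ → 1 ≤ i → i < length δ → MatesInRange δ → MatesInRange (conj i δ)
MatesInRange-conj i δ 1≤i i<n inRange = MatesInRange-by-positions (conj i δ) inPosition
  where
  inPosition : ∀ k j → k < length (conj i δ) → at (conj i δ) (suc k) ≡ just (mate j) → (1 ≤ j) × (j ≤ length (conj i δ))
  inPosition k j k<n h rewrite length-conj i δ
    with uncurry (at-within δ (sw i (suc k))) (sw-range 1≤i i<n (s≤s z≤n) k<n)
  ... | sgn s , eq with () ← trans (sym h) (trans (at-conj i δ k k<n) (cong (just ∘ conjEntry i) (entryAt-just δ (sw i (suc k)) (sgn s) eq)))
  ... | mate j' , eq with refl ← trans (sym h) (trans (at-conj i δ k k<n) (cong (just ∘ conjEntry i) (entryAt-just δ (sw i (suc k)) (mate j') eq)))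
    = uncurry (sw-range 1≤i i<n) (inRange (sw i (suc k)) j' eq)

MatesInRange-matchPair : ∀ i δ → 1 ≤ i → i < length δ → MatesInRange δ → MatesInRange (matchPair i δ)
MatesInRange-matchPair i δ 1≤i i<n inRange = MatesInRange-by-positions (matchPair i δ) inPosition
  where
  inPosition : ∀ k j → k < length (matchPair i δ) → at (matchPair i δ) (suc k) ≡ just (mate j) → (1 ≤ j) × (j ≤ length (matchPair i δ))
  inPosition k j k<n h rewrite length-matchPair i δ with trans (sym h) (at-matchPair i δ k k<n) | swCase i (suc k)
  ... | eq | at-i refl rewrite matchPairEntry-i i δ with refl ← eq = s≤s z≤n , i<n
  ... | eq | at-1+i refl rewrite matchPairEntry-1+i k δ with refl ← eq = 1≤i , <⇒≤ i<n
  ... | eq | outside k≢i k≢1+i rewrite matchPairEntry-other i δ k≢i k≢1+i with at-inside δ k k<n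
  ...   | e , atk rewrite entryAt-just δ (suc k) e atk with refl ← eq = inRange (suc k) j atk

MatesInRange-star : ∀ x δ δ' → MatesInRange δ → star x δ ≡ just δ' → MatesInRange δ'
MatesInRange-star x δ δ' inRange st with star-step x δ δ' st
... | 1≤x , x<n , byConj refl = MatesInRange-conj x δ 1≤x x<n inRange
... | 1≤x , x<n , byMatch _ _ refl = MatesInRange-matchPair x δ 1≤x x<n inRange

entryAt-shift1-mid : ∀ δ y → 1 ≤ y → y ≤ length δ → entryAt (shift1 δ) (suc y) ≡ bump (entryAt δ y)
entryAt-shift1-mid δ (suc y) _ y<n with at-inside δ y y<n
... | e , eq = trans (entryAt-just (shift1 δ) (suc (suc y)) (bump e) (trans (at-shift1-mid δ y y<n) (cong (mmap bump) eq)))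
                     (cong bump (sym (entryAt-just δ (suc y) e eq)))

conjEntry-bump : ∀ i e → conjEntry (suc i) (bump e) ≡ bump (conjEntry i e)
conjEntry-bump i (sgn s) = refl
conjEntry-bump i (mate j) = cong mate (sw-suc i j)

sw-fixes-1 : ∀ {i} → 1 ≤ i → sw (suc i) 1 ≡ 1
sw-fixes-1 {suc i} _ = sw-other {suc (suc i)} {1} (λ ()) (λ ())

sw-fixes-end : ∀ {i n} → i < n → sw (suc i) (suc (suc n)) ≡ suc (suc n)
sw-fixes-end {i} {n} i<n = sw-other (>⇒≢ (s≤s (≤-trans i<n (n≤1+n n)))) (>⇒≢ (s≤s (s≤s i<n)))

conj-shift1 : ∀ i δ → 1 ≤ i → i < length δ → conj (suc i) (shift1 δ) ≡ shift1 (conj i δ)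
conj-shift1 i δ 1≤i i<n = shift1-by-entries n (conj (suc i) Δ) (conj i δ) (length-conj i δ)
  (trans (length-conj (suc i) Δ) (length-shift1 δ)) first mid last
  where
  n = length δ
  Δ = shift1 δ
  n+2≡ : n + 2 ≡ suc (suc n)
  n+2≡ = +-comm n 2
  first : at (conj (suc i) Δ) 1 ≡ just (mate (n + 2))
  first = begin
    at (conj (suc i) Δ) 1                                  ≡⟨ at-conj (suc i) Δ 0 (s≤s z≤n) ⟩
    just (conjEntry (suc i) (entryAt Δ (sw (suc i) 1)))    ≡⟨ cong (λ k → just (conjEntry (suc i) (entryAt Δ k))) (sw-fixes-1 1≤i) ⟩
    just (mate (sw (suc i) (n + 2)))                       ≡⟨ cong (λ k → just (mate (sw (suc i) k))) n+2≡ ⟩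
    just (mate (sw (suc i) (suc (suc n))))                 ≡⟨ cong (just ∘ mate) (trans (sw-fixes-end i<n) (sym n+2≡)) ⟩
    just (mate (n + 2))                                    ∎
    where open ≡-Reasoning
  mid : ∀ k → k < n → at (conj (suc i) Δ) (suc (suc k)) ≡ mmap bump (at (conj i δ) (suc k))
  mid k k<n = begin
    at (conj (suc i) Δ) (suc (suc k))
      ≡⟨ at-conj (suc i) Δ (suc k) (subst (suc k <_) (sym (length-shift1 δ)) (s≤s (≤-trans k<n (n≤1+n n)))) ⟩
    just (conjEntry (suc i) (entryAt Δ (sw (suc i) (suc (suc k)))))
      ≡⟨ cong (λ l → just (conjEntry (suc i) (entryAt Δ l))) (sw-suc i (suc k)) ⟩
    just (conjEntry (suc i) (entryAt Δ (suc (sw i (suc k)))))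
      ≡⟨ cong (just ∘ conjEntry (suc i)) (uncurry (entryAt-shift1-mid δ (sw i (suc k))) (sw-range 1≤i i<n (s≤s z≤n) k<n)) ⟩
    just (conjEntry (suc i) (bump (entryAt δ (sw i (suc k)))))
      ≡⟨ cong just (conjEntry-bump i (entryAt δ (sw i (suc k)))) ⟩
    mmap bump (just (conjEntry i (entryAt δ (sw i (suc k)))))
      ≡⟨ cong (mmap bump) (sym (at-conj i δ k k<n)) ⟩
    mmap bump (at (conj i δ) (suc k))
      ∎
    where open ≡-Reasoning
  last : at (conj (suc i) Δ) (suc (suc n)) ≡ just (mate 1)
  last = begin
    at (conj (suc i) Δ) (suc (suc n))
      ≡⟨ at-conj (suc i) Δ (suc n) (subst (suc n <_) (sym (length-shift1 δ)) ≤-refl) ⟩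
    just (conjEntry (suc i) (entryAt Δ (sw (suc i) (suc (suc n)))))
      ≡⟨ cong (λ l → just (conjEntry (suc i) (entryAt Δ l))) (sw-fixes-end i<n) ⟩
    just (conjEntry (suc i) (entryAt Δ (suc (suc n))))
      ≡⟨ cong (just ∘ conjEntry (suc i)) (entryAt-just Δ (suc (suc n)) (mate 1) (at-shift1-last δ)) ⟩
    just (mate (sw (suc i) 1))
      ≡⟨ cong (just ∘ mate) (sw-fixes-1 1≤i) ⟩
    just (mate 1)
      ∎
    where open ≡-Reasoning

matchPairEntry-shift1 : ∀ i δ k → k < length δ →
  matchPairEntry (suc i) (shift1 δ) (suc (suc k)) ≡ bump (matchPairEntry i δ (suc k))
matchPairEntry-shift1 i δ k k<n with swCase i (suc k)
... | at-i refl rewrite matchPairEntry-i (suc (suc k)) (shift1 δ) | matchPairEntry-i (suc k) δ = refl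
... | at-1+i refl rewrite matchPairEntry-1+i (suc k) (shift1 δ) | matchPairEntry-1+i k δ = refl
... | outside k≢i k≢1+i
  rewrite matchPairEntry-other (suc i) (shift1 δ) {suc (suc k)} (k≢i ∘ suc-injective) (k≢1+i ∘ suc-injective)
        | matchPairEntry-other i δ k≢i k≢1+i = entryAt-shift1-mid δ (suc k) (s≤s z≤n) k<n

matchPair-shift1 : ∀ i δ → 1 ≤ i → i < length δ → matchPair (suc i) (shift1 δ) ≡ shift1 (matchPair i δ)
matchPair-shift1 i δ 1≤i i<n = shift1-by-entries n (matchPair (suc i) Δ) (matchPair i δ) (length-matchPair i δ)
  (trans (length-matchPair (suc i) Δ) (length-shift1 δ)) first mid last
  where
  n = length δ
  Δ = shift1 δ
  1≢1+i : 1 ≢ suc i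
  1≢1+i = >⇒≢ (s≤s 1≤i) ∘ sym
  first : at (matchPair (suc i) Δ) 1 ≡ just (mate (n + 2))
  first = trans (at-matchPair (suc i) Δ 0 (s≤s z≤n)) (cong just (matchPairEntry-other (suc i) Δ 1≢1+i (λ ())))
  mid : ∀ k → k < n → at (matchPair (suc i) Δ) (suc (suc k)) ≡ mmap bump (at (matchPair i δ) (suc k))
  mid k k<n = begin
    at (matchPair (suc i) Δ) (suc (suc k))
      ≡⟨ at-matchPair (suc i) Δ (suc k) (subst (suc k <_) (sym (length-shift1 δ)) (s≤s (≤-trans k<n (n≤1+n n)))) ⟩
    just (matchPairEntry (suc i) Δ (suc (suc k)))
      ≡⟨ cong just (matchPairEntry-shift1 i δ k k<n) ⟩
    mmap bump (just (matchPairEntry i δ (suc k)))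
      ≡⟨ cong (mmap bump) (sym (at-matchPair i δ k k<n)) ⟩
    mmap bump (at (matchPair i δ) (suc k))
      ∎
    where open ≡-Reasoning
  last : at (matchPair (suc i) Δ) (suc (suc n)) ≡ just (mate 1)
  last = begin
    at (matchPair (suc i) Δ) (suc (suc n))
      ≡⟨ at-matchPair (suc i) Δ (suc n) (subst (suc n <_) (sym (length-shift1 δ)) ≤-refl) ⟩
    just (matchPairEntry (suc i) Δ (suc (suc n)))
      ≡⟨ cong just (matchPairEntry-other (suc i) Δ (>⇒≢ (s≤s (≤-trans i<n (n≤1+n n)))) (>⇒≢ (s≤s (s≤s i<n)))) ⟩
    just (entryAt Δ (suc (suc n)))
      ≡⟨ cong just (entryAt-just Δ (suc (suc n)) (mate 1) (at-shift1-last δ)) ⟩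
    just (mate 1)
      ∎
    where open ≡-Reasoning

starCase-shift1 : ∀ i δ → 1 ≤ i → i < length δ → ∀ a b →
  starCase (suc i) (shift1 δ) (mmap bump a) (mmap bump b) ≡ mmap shift1 (starCase i δ a b)
starCase-shift1 i δ 1≤i i<n nothing b = cong just (conj-shift1 i δ 1≤i i<n)
starCase-shift1 i δ 1≤i i<n (just (mate j)) b with j ≡ᵇ suc i
... | true = refl
... | false = cong just (conj-shift1 i δ 1≤i i<n)
starCase-shift1 i δ 1≤i i<n (just (sgn s)) nothing = cong just (conj-shift1 i δ 1≤i i<n)
starCase-shift1 i δ 1≤i i<n (just (sgn s)) (just (mate j)) = cong just (conj-shift1 i δ 1≤i i<n)
starCase-shift1 i δ 1≤i i<n (just (sgn s)) (just (sgn t)) with s xor t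
... | true = cong just (matchPair-shift1 i δ 1≤i i<n)
... | false = refl

star-shift1 : ∀ i δ → 1 ≤ i → i < length δ → star (suc i) (shift1 δ) ≡ mmap shift1 (star i δ)
star-shift1 i δ 1≤i i<n = begin
    star (suc i) Δ
  ≡⟨ star-unfold (suc i) Δ (s≤s z≤n) (subst (suc i <_) (sym (length-shift1 δ)) (≤-trans (s≤s i<n) (n≤1+n _))) ⟩
    starCase (suc i) Δ (at Δ (suc i)) (at Δ (suc (suc i)))
  ≡⟨ cong₂ (starCase (suc i) Δ) (at-shift1-i 1≤i) (at-shift1-mid δ i i<n) ⟩
    starCase (suc i) Δ (mmap bump (at δ i)) (mmap bump (at δ (suc i)))
  ≡⟨ starCase-shift1 i δ 1≤i i<n (at δ i) (at δ (suc i)) ⟩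
    mmap shift1 (starCase i δ (at δ i) (at δ (suc i)))
  ≡⟨ cong (mmap shift1) (sym (star-unfold i δ 1≤i i<n)) ⟩
    mmap shift1 (star i δ)
  ∎
  where
  open ≡-Reasoning
  Δ = shift1 δ
  at-shift1-i : 1 ≤ i → at Δ (suc i) ≡ mmap bump (at δ i)
  at-shift1-i (s≤s {n = i'} z≤n) = at-shift1-mid δ i' (<-trans (n<1+n i') i<n)

gpqChoice : Bool → Bool → ℕ → Bool → Entry
gpqChoice first last u s = if first then mate u else (if last then mate u else sgn s)

gpqEntry : ℕ → ℕ → ℕ → Entry
gpqEntry p q k = gpqChoice (k ≤ᵇ (p ⊓ q)) (((p + q) ∸ (p ⊓ q)) <ᵇ k) (suc (p + q) ∸ k) (q <ᵇ p)

at-gpq : ∀ p q k → k < p + q → at (gpq p q) (suc k) ≡ just (gpqEntry p q (suc k))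
at-gpq p q = at-tabulated (gpqEntry p q) id (p + q)

length-gpq : ∀ p q → length (gpq p q) ≡ p + q
length-gpq p q = trans (length-map _ (map suc (upTo (p + q)))) (trans (length-map suc (upTo (p + q))) (length-upTo (p + q)))

gpqChoice-bump : ∀ first last u s → gpqChoice first last (suc u) s ≡ bump (gpqChoice first last u s)
gpqChoice-bump true last u s = refl
gpqChoice-bump false true u s = refl
gpqChoice-bump false false u s = refl

min≤sum : ∀ p q → p ⊓ q ≤ p + q
min≤sum p q = ≤-trans (m⊓n≤m p q) (m≤m+n p q)

1+p+1+q : ∀ p q → suc p + suc q ≡ suc (suc (p + q))
1+p+1+q p q = cong suc (+-suc p q)

n∸m-suc : ∀ p q → (suc p + suc q) ∸ (suc p ⊓ suc q) ≡ suc ((p + q) ∸ (p ⊓ q))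
n∸m-suc p q = trans (cong (_∸ (p ⊓ q)) (+-suc p q)) (+-∸-assoc 1 (min≤sum p q))

gpqEntry-mid : ∀ p q k → k < p + q → gpqEntry (suc p) (suc q) (suc (suc k)) ≡ bump (gpqEntry p q (suc k))
gpqEntry-mid p q k k<n = begin
    gpqEntry (suc p) (suc q) (suc (suc k))
  ≡⟨ cong₂ (λ last u → gpqChoice (k <ᵇ (p ⊓ q)) last u (q <ᵇ p)) (cong (_<ᵇ suc (suc k)) (n∸m-suc p q)) mate-index ⟩
    gpqChoice (k <ᵇ (p ⊓ q)) (((p + q) ∸ (p ⊓ q)) <ᵇ suc k) (suc (suc (p + q) ∸ suc k)) (q <ᵇ p)
  ≡⟨ gpqChoice-bump (k <ᵇ (p ⊓ q)) _ _ (q <ᵇ p) ⟩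
    bump (gpqEntry p q (suc k))
  ∎
  where
  open ≡-Reasoning
  mate-index : suc (suc p + suc q) ∸ suc (suc k) ≡ suc (suc (p + q) ∸ suc k)
  mate-index = trans (cong (_∸ k) (+-suc p q)) (+-∸-assoc 1 (<⇒≤ k<n))

gpqEntry-last : ∀ p q → gpqEntry (suc p) (suc q) (suc (suc (p + q))) ≡ mate 1
gpqEntry-last p q rewrite <ᵇ-false (min≤sum p q) | n∸m-suc p q
  | <ᵇ-true (s≤s (s≤s (m∸n≤m (p + q) (p ⊓ q)))) | +-suc p q = cong mate (m+n∸n≡m 1 (p + q))

gpq-shift1 : ∀ p q → gpq (suc p) (suc q) ≡ shift1 (gpq p q)
gpq-shift1 p q = shift1-by-entries (p + q) (gpq (suc p) (suc q)) (gpq p q) (length-gpq p q)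
  (trans (length-gpq (suc p) (suc q)) (1+p+1+q p q)) first mid last
  where
  first : at (gpq (suc p) (suc q)) 1 ≡ just (mate (p + q + 2))
  first = cong (just ∘ mate) (trans (1+p+1+q p q) (+-comm 2 (p + q)))
  mid : ∀ k → k < p + q → at (gpq (suc p) (suc q)) (suc (suc k)) ≡ mmap bump (at (gpq p q) (suc k))
  mid k k<n = trans (at-gpq (suc p) (suc q) (suc k) (subst (suc k <_) (sym (1+p+1+q p q)) (s≤s (≤-trans k<n (n≤1+n _)))))
    (trans (cong just (gpqEntry-mid p q k k<n)) (cong (mmap bump) (sym (at-gpq p q k k<n))))
  last : at (gpq (suc p) (suc q)) (suc (suc (p + q))) ≡ just (mate 1)
  last = trans (at-gpq (suc p) (suc q) (suc (p + q)) (subst (suc (p + q) <_) (sym (1+p+1+q p q)) ≤-refl))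
    (cong just (gpqEntry-last p q))

bump-injective : ∀ {a b} → bump a ≡ bump b → a ≡ b
bump-injective {sgn s} {sgn .s} refl = refl
bump-injective {mate j} {mate .j} refl = refl

shift1-injective : ∀ δ δ' → shift1 δ ≡ shift1 δ' → δ ≡ δ'
shift1-injective δ δ' eq = map-injective bump-injective (∷ʳ-injectiveˡ (map bump δ) (map bump δ') (∷-injectiveʳ eq))

-- In γ^{+1} the value n+2 sits at position 1 and the value 1 at position
-- n+2; conjugating by s₁ (resp. s_{n+1}) moves them inwards, and the
-- remaining values are relabelled monotonically, so at most as many
-- inversions are created as are destroyed.

-- a value x of γ becomes x+1 in γ^{+1} and s₁(x+1) after conjugating by s₁:
-- relabel₁ 1 = 1 and relabel₁ x = x+1 for x ≥ 2, order-preserving on x ≥ 1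
relabel₁ : ℕ → ℕ
relabel₁ x = sw 1 (suc x)

relabel₁-mono : ∀ a b → 1 ≤ a → 1 ≤ b → (relabel₁ b <ᵇ relabel₁ a) ≡ (b <ᵇ a)
relabel₁-mono (suc zero) (suc zero) _ _ = refl
relabel₁-mono (suc zero) (suc (suc b)) _ _ = refl
relabel₁-mono (suc (suc a)) (suc zero) _ _ = refl
relabel₁-mono (suc (suc a)) (suc (suc b)) _ _ = refl

relabel₁-≤ : ∀ x → 1 ≤ x → relabel₁ x ≤ suc x
relabel₁-≤ (suc zero) _ = s≤s z≤n
relabel₁-≤ (suc (suc x)) _ = ≤-refl

-- the sequence of s₁ γ^{+1} s₁ is  s₁(a₀+1), n+2, s₁(a₁+1), …, s₁(a_{n-1}+1), 2
-- where a is the sequence of γ (values in [1,n], n = m+1)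
first-swap-bound : ∀ m (a G : ℕ → ℕ) → (∀ k → k < suc m → (1 ≤ a k) × (a k ≤ suc m)) →
  G 0 ≡ relabel₁ (a 0) → G 1 ≡ suc (suc (suc m)) →
  (∀ k → k < m → G (suc (suc k)) ≡ relabel₁ (a (suc k))) → G (suc (suc m)) ≡ 2 →
  Inversions (suc (suc (suc m))) G ≤ suc (suc m) + (Inversions (suc m) a + suc m)
first-swap-bound m a G range G0 G1 Gmid Gend = begin
    Inversions (suc (suc (suc m))) G
  ≡⟨⟩
    (𝟙 (G 1 <ᵇ G 0) + sumBelow (suc m) (λ l → 𝟙 (g l <ᵇ G 0))) + (sumBelow (suc m) (λ l → 𝟙 (g l <ᵇ G 1)) + Inversions (suc m) g)
  ≤⟨ +-mono-≤ (+-mono-≤ (≤-reflexive firstPair) secondColumn) (+-mono-≤ (sumBelow-𝟙 (suc m) (λ l → g l <ᵇ G 1)) rest) ⟩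
    (0 + (Rₐ + 1)) + (suc m + (Jₐ + m))
  ≤⟨ m≤m+n _ 1 ⟩
    (0 + (Rₐ + 1)) + (suc m + (Jₐ + m)) + 1
  ≡⟨ rearrange Rₐ Jₐ m ⟩
    suc (suc m) + ((Rₐ + Jₐ) + suc m)
  ∎
  where
  open ≤-Reasoning
  g = G ∘ suc ∘ suc
  -- Inversions (suc m) a = Rₐ + Jₐ, splitting off position 0
  Rₐ = sumBelow m (λ l → 𝟙 (a (suc l) <ᵇ a 0))
  Jₐ = Inversions m (a ∘ suc)
  rearrange : ∀ Rₐ Jₐ m → (0 + (Rₐ + 1)) + (suc m + (Jₐ + m)) + 1 ≡ suc (suc m) + ((Rₐ + Jₐ) + suc m)
  rearrange = solve-∀
  a0 = range 0 (s≤s z≤n)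
  a-mid : ∀ k → k < m → 1 ≤ a (suc k)
  a-mid k k<m = proj₁ (range (suc k) (s≤s k<m))
  firstPair : 𝟙 (G 1 <ᵇ G 0) ≡ 0
  firstPair rewrite G1 | G0 = cong 𝟙 (<ᵇ-false (≤-trans (relabel₁-≤ (a 0) (proj₁ a0)) (≤-trans (s≤s (proj₂ a0)) (n≤1+n _))))
  secondColumn : sumBelow (suc m) (λ l → 𝟙 (g l <ᵇ G 0)) ≤ Rₐ + 1
  secondColumn = begin
      sumBelow (suc m) (λ l → 𝟙 (g l <ᵇ G 0))
    ≡⟨ sumBelow-last m (λ l → 𝟙 (g l <ᵇ G 0)) ⟩
      sumBelow m (λ l → 𝟙 (g l <ᵇ G 0)) + 𝟙 (g m <ᵇ G 0)
    ≤⟨ +-mono-≤ (≤-reflexive (sumBelow-cong m (λ l l<m → cong 𝟙 (trans (cong₂ _<ᵇ_ (Gmid l l<m) G0)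
                    (relabel₁-mono (a 0) (a (suc l)) (proj₁ a0) (a-mid l l<m)))))) (𝟙≤1 _) ⟩
      Rₐ + 1
    ∎
  rest : Inversions (suc m) g ≤ Jₐ + m
  rest = begin
      Inversions (suc m) g
    ≡⟨ Inversions-last m g ⟩
      Inversions m g + sumBelow m (λ k → 𝟙 (g m <ᵇ g k))
    ≤⟨ +-mono-≤ (≤-reflexive (Inversions-cong m {g} {a ∘ suc} (λ k l k<m l<m → trans (cong₂ _<ᵇ_ (Gmid l l<m) (Gmid k k<m))
                    (relabel₁-mono (a (suc k)) (a (suc l)) (a-mid k k<m) (a-mid l l<m)))))
                (sumBelow-𝟙 m (λ k → g m <ᵇ g k)) ⟩
      Jₐ + m
    ∎

relabelₙ : ℕ → ℕ → ℕ
relabelₙ n x = sw (suc n) (suc x)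

relabelₙ-< : ∀ n x → x < n → relabelₙ n x ≡ suc x
relabelₙ-< n x x<n = sw-other (λ e → <-irrefl (suc-injective e) x<n) (λ e → <-irrefl (suc-injective e) (≤-trans x<n (n≤1+n n)))

relabelₙ-n : ∀ n → relabelₙ n n ≡ suc (suc n)
relabelₙ-n n = sw-left (suc n)

relabelₙ-mono : ∀ n a b → a ≤ n → b ≤ n → (relabelₙ n b <ᵇ relabelₙ n a) ≡ (b <ᵇ a)
relabelₙ-mono n a b a≤n b≤n with m≤n⇒m<n∨m≡n a≤n | m≤n⇒m<n∨m≡n b≤n
... | inj₁ a<n | inj₁ b<n rewrite relabelₙ-< n a a<n | relabelₙ-< n b b<n = refl
... | inj₂ refl | inj₁ b<a rewrite relabelₙ-< a b b<a | relabelₙ-n a = trans (<ᵇ-true (≤-trans (s≤s b<a) (n≤1+n _))) (sym (<ᵇ-true b<a))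
... | inj₁ a<b | inj₂ refl rewrite relabelₙ-< b a a<b | relabelₙ-n b = trans (<ᵇ-false (≤-trans a<b (≤-trans (n≤1+n _) (n≤1+n _)))) (sym (<ᵇ-false (<⇒≤ a<b)))
... | inj₂ refl | inj₂ refl rewrite relabelₙ-n a = trans (<ᵇ-false {suc (suc a)} ≤-refl) (sym (<ᵇ-false {a} ≤-refl))

relabelₙ-positive : ∀ n x → x ≤ n → 1 ≤ relabelₙ n x
relabelₙ-positive n x x≤n with m≤n⇒m<n∨m≡n x≤n
... | inj₁ x<n rewrite relabelₙ-< n x x<n = s≤s z≤n
... | inj₂ refl rewrite relabelₙ-n x = s≤s z≤n

-- the sequence of s_{n+1} γ^{+1} s_{n+1} is
-- n+2, a₀+1, …, a_{n-2}+1, 1, s_{n+1}(a_{n-1}+1)   (n = m+1)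
last-swap-bound : ∀ m (a G : ℕ → ℕ) → (∀ k → k < suc m → a k ≤ suc m) →
  (∀ k → k < m → G (suc k) ≡ relabelₙ (suc m) (a k)) → G (suc m) ≡ 1 → G (suc (suc m)) ≡ relabelₙ (suc m) (a m) →
  Inversions (suc (suc (suc m))) G ≤ suc (suc m) + (Inversions (suc m) a + suc m)
last-swap-bound m a G range Gmid Gm GN = begin
    Inversions (suc (suc n)) G
  ≡⟨ cong (sumBelow (suc n) (λ l → 𝟙 (G (suc l) <ᵇ G 0)) +_) (Inversions-last n (G ∘ suc)) ⟩
    sumBelow (suc n) (λ l → 𝟙 (G (suc l) <ᵇ G 0)) + (Inversions n (G ∘ suc) + sumBelow n lastColumn)
  ≤⟨ +-mono-≤ (sumBelow-𝟙 (suc n) (λ l → G (suc l) <ᵇ G 0)) (+-mono-≤ middle (≤-reflexive lastColumn≡)) ⟩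
    suc n + ((Jₐ + m) + (Cₐ + 0))
  ≤⟨ m≤m+n _ 1 ⟩
    suc n + ((Jₐ + m) + (Cₐ + 0)) + 1
  ≡⟨ rearrange Jₐ Cₐ m ⟩
    suc (suc m) + ((Jₐ + Cₐ) + suc m)
  ≡⟨ cong (λ z → suc (suc m) + (z + suc m)) (sym (Inversions-last m a)) ⟩
    suc (suc m) + (Inversions (suc m) a + suc m)
  ∎
  where
  open ≤-Reasoning
  n = suc m
  Jₐ = Inversions m a
  Cₐ = sumBelow m (λ k → 𝟙 (a m <ᵇ a k))
  rearrange : ∀ Jₐ Cₐ m → suc (suc m) + ((Jₐ + m) + (Cₐ + 0)) + 1 ≡ suc (suc m) + ((Jₐ + Cₐ) + suc m)
  rearrange = solve-∀
  lastColumn : ℕ → ℕ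
  lastColumn k = 𝟙 (G (suc n) <ᵇ G (suc k))
  a≤n : ∀ k → k < m → a k ≤ n
  a≤n k k<m = range k (≤-trans k<m (n≤1+n m))
  middle : Inversions n (G ∘ suc) ≤ Jₐ + m
  middle = begin
      Inversions (suc m) (G ∘ suc)
    ≡⟨ Inversions-last m (G ∘ suc) ⟩
      Inversions m (G ∘ suc) + sumBelow m (λ k → 𝟙 (G (suc m) <ᵇ G (suc k)))
    ≤⟨ +-mono-≤ (≤-reflexive (Inversions-cong m {G ∘ suc} {a} (λ k l k<m l<m → trans (cong₂ _<ᵇ_ (Gmid l l<m) (Gmid k k<m))
                    (relabelₙ-mono n (a k) (a l) (a≤n k k<m) (a≤n l l<m)))))
                (sumBelow-𝟙 m (λ k → G (suc m) <ᵇ G (suc k))) ⟩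
      Jₐ + m
    ∎
  lastColumn≡ : sumBelow n lastColumn ≡ Cₐ + 0
  lastColumn≡ = begin-equality
      sumBelow (suc m) lastColumn
    ≡⟨ sumBelow-last m lastColumn ⟩
      sumBelow m lastColumn + lastColumn m
    ≡⟨ cong₂ _+_ (sumBelow-cong m (λ k k<m → cong 𝟙 (trans (cong₂ _<ᵇ_ GN (Gmid k k<m))
                    (relabelₙ-mono n (a k) (a m) (a≤n k k<m) (range m ≤-refl)))))
                 (cong 𝟙 (trans (cong₂ _<ᵇ_ GN Gm) (<ᵇ-false (relabelₙ-positive n (a m) (range m ≤-refl))))) ⟩
      Cₐ + 0
    ∎

inv-shift1-Inversions : ∀ δ m → length δ ≡ suc m → MatesInRange δ →
  inv (shift1 δ) ≡ suc (suc m) + (Inversions (suc m) (ι₀ δ) + suc m)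
inv-shift1-Inversions δ m len inRange = trans (inv-shift1 δ inRange)
  (trans (cong (λ z → suc (length δ) + (z + length δ)) (inv-Inversions δ))
         (cong (λ n → suc n + (Inversions n (ι₀ δ) + n)) len))

ι₀-range-suc : ∀ δ m → length δ ≡ suc m → MatesInRange δ → ∀ k → k < suc m → (1 ≤ ι₀ δ k) × (ι₀ δ k ≤ suc m)
ι₀-range-suc δ m len inRange = subst (λ n → ∀ k → k < n → (1 ≤ ι₀ δ k) × (ι₀ δ k ≤ n)) len (ι₀-range δ inRange)

conj-first-not-longer : ∀ δ m → length δ ≡ suc m → MatesInRange δ → inv (conj 1 (shift1 δ)) ≤ inv (shift1 δ)
conj-first-not-longer δ m len inRange = begin
    inv (conj 1 Δ)
  ≡⟨ inv-Inversions (conj 1 Δ) ⟩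
    Inversions (length (conj 1 Δ)) G
  ≡⟨ cong (λ z → Inversions z G) (trans (length-conj 1 Δ) |Δ|) ⟩
    Inversions (suc (suc (suc m))) G
  ≤⟨ first-swap-bound m a G (ι₀-range-suc δ m len inRange) G0 G1 Gmid Gend ⟩
    suc (suc m) + (Inversions (suc m) a + suc m)
  ≡⟨ sym (inv-shift1-Inversions δ m len inRange) ⟩
    inv Δ
  ∎
  where
  open ≤-Reasoning
  Δ = shift1 δ
  a = ι₀ δ
  G = ι₀ (conj 1 Δ)
  |Δ| : length Δ ≡ suc (suc (suc m))
  |Δ| = trans (length-shift1 δ) (cong (suc ∘ suc) len)
  inΔ : ∀ k → k ≤ suc (suc m) → k < length Δ
  inΔ k k≤ = subst (k <_) (sym |Δ|) (s≤s k≤)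
  inδ : ∀ k → k ≤ m → k < length δ
  inδ k k≤m = subst (k <_) (sym len) (s≤s k≤m)
  G≡ : ∀ k → k ≤ suc (suc m) → G k ≡ sw 1 (invol Δ (sw 1 (suc k)))
  G≡ k k≤ = ι₀-conj 1 Δ k (s≤s z≤n) (inΔ 1 (s≤s z≤n)) (inΔ k k≤)
  G0 : G 0 ≡ relabel₁ (a 0)
  G0 = trans (G≡ 0 z≤n) (cong (sw 1) (ι₀-shift1-mid δ 0 (inδ 0 z≤n)))
  G1 : G 1 ≡ suc (suc (suc m))
  G1 = trans (G≡ 1 (s≤s z≤n)) (cong (sw 1) (trans (+-comm (length δ) 2) (cong (suc ∘ suc) len)))
  Gmid : ∀ k → k < m → G (suc (suc k)) ≡ relabel₁ (a (suc k))
  Gmid k k<m = trans (G≡ (suc (suc k)) (s≤s (s≤s (<⇒≤ k<m)))) (cong (sw 1) (ι₀-shift1-mid δ (suc k) (inδ (suc k) k<m)))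
  Gend : G (suc (suc m)) ≡ 2
  Gend = trans (G≡ (suc (suc m)) ≤-refl) (cong (sw 1) (subst (λ n → ι₀ Δ n ≡ 1) (cong suc len) (ι₀-shift1-last δ)))

conj-last-not-longer : ∀ δ m → length δ ≡ suc m → MatesInRange δ → inv (conj (suc (length δ)) (shift1 δ)) ≤ inv (shift1 δ)
conj-last-not-longer δ m len inRange = begin
    inv (conj (suc n) Δ)
  ≡⟨ inv-Inversions (conj (suc n) Δ) ⟩
    Inversions (length (conj (suc n) Δ)) G
  ≡⟨ cong (λ z → Inversions z G) (trans (length-conj (suc n) Δ) |Δ|) ⟩
    Inversions (suc (suc (suc m))) G
  ≤⟨ last-swap-bound m a G (λ k k<n → proj₂ (ι₀-range-suc δ m len inRange k k<n)) Gmid Gm GN ⟩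
    suc (suc m) + (Inversions (suc m) a + suc m)
  ≡⟨ sym (inv-shift1-Inversions δ m len inRange) ⟩
    inv Δ
  ∎
  where
  open ≤-Reasoning
  n = length δ
  Δ = shift1 δ
  a = ι₀ δ
  G = ι₀ (conj (suc n) Δ)
  |Δ| : length Δ ≡ suc (suc (suc m))
  |Δ| = trans (length-shift1 δ) (cong (suc ∘ suc) len)
  inΔ : ∀ k → k ≤ suc n → k < length Δ
  inΔ k k≤ = subst (k <_) (sym (length-shift1 δ)) (s≤s k≤)
  G≡ : ∀ k → k ≤ suc n → G k ≡ sw (suc n) (invol Δ (sw (suc n) (suc k)))
  G≡ k k≤ = ι₀-conj (suc n) Δ k (s≤s z≤n) (inΔ (suc n) ≤-refl) (inΔ k k≤)
  Gmid : ∀ k → k < m → G (suc k) ≡ relabelₙ (suc m) (a k)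
  Gmid k k<m = begin-equality
      G (suc k)
    ≡⟨ G≡ (suc k) (s≤s (≤-trans (<⇒≤ k<m) (≤-trans (n≤1+n m) (≤-reflexive (sym len))))) ⟩
      sw (suc n) (invol Δ (sw (suc n) (suc (suc k))))
    ≡⟨ cong (λ z → sw (suc n) (invol Δ z)) (sw-other {suc n} {suc (suc k)}
         (λ e → <-irrefl (suc-injective (trans (suc-injective e) len)) k<m) (λ e → <-irrefl (suc-injective (suc-injective e)) k<n)) ⟩
      sw (suc n) (ι₀ Δ (suc k))
    ≡⟨ cong₂ sw (cong suc len) (ι₀-shift1-mid δ k k<n) ⟩
      relabelₙ (suc m) (a k)
    ∎
    where
    k<n : k < n
    k<n = subst (k <_) (sym len) (≤-trans k<m (n≤1+n m))
  Gm : G (suc m) ≡ 1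
  Gm = begin-equality
      G (suc m)
    ≡⟨ G≡ (suc m) (≤-trans (≤-reflexive (sym len)) (n≤1+n n)) ⟩
      sw (suc n) (invol Δ (sw (suc n) (suc (suc m))))
    ≡⟨ cong (λ z → sw (suc n) (invol Δ (sw (suc n) (suc z)))) (sym len) ⟩
      sw (suc n) (invol Δ (sw (suc n) (suc n)))
    ≡⟨ cong (λ z → sw (suc n) (invol Δ z)) (sw-left (suc n)) ⟩
      sw (suc n) (ι₀ Δ (suc n))
    ≡⟨ cong (sw (suc n)) (ι₀-shift1-last δ) ⟩
      sw (suc n) 1
    ≡⟨ sw-other {suc n} {1} (λ e → 1+n≢0 (sym (suc-injective (trans e (cong suc len))))) (λ ()) ⟩
      1
    ∎
  GN : G (suc (suc m)) ≡ relabelₙ (suc m) (a m)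
  GN = begin-equality
      G (suc (suc m))
    ≡⟨ cong G (cong suc (sym len)) ⟩
      G (suc n)
    ≡⟨ G≡ (suc n) ≤-refl ⟩
      sw (suc n) (invol Δ (sw (suc n) (suc (suc n))))
    ≡⟨ cong (λ z → sw (suc n) (invol Δ z)) (sw-right (suc n)) ⟩
      sw (suc n) (ι₀ Δ n)
    ≡⟨ cong (λ z → sw (suc n) (ι₀ Δ z)) len ⟩
      sw (suc n) (ι₀ Δ (suc m))
    ≡⟨ cong₂ sw (cong suc len) (ι₀-shift1-mid δ m (subst (m <_) (sym len) ≤-refl)) ⟩
      relabelₙ (suc m) (a m)
    ∎

MatesInRange-shift1 : ∀ δ → MatesInRange δ → MatesInRange (shift1 δ)
MatesInRange-shift1 δ inRange (suc zero) j refl =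
  ≤-trans (s≤s z≤n) (m≤n+m 2 (length δ)) , ≤-reflexive (trans (+-comm (length δ) 2) (sym (length-shift1 δ)))
MatesInRange-shift1 δ inRange (suc (suc k)) j h
  with m≤n⇒m<n∨m≡n (≤-pred (≤-pred (subst (suc (suc k) ≤_) (length-shift1 δ) (proj₂ (at-range (shift1 δ) _ h)))))
... | inj₁ k<n with at-inside δ k k<n
...   | sgn s , eq with () ← trans (sym h) (trans (at-shift1-mid δ k k<n) (cong (mmap bump) eq))
...   | mate j' , eq with refl ← trans (sym h) (trans (at-shift1-mid δ k k<n) (cong (mmap bump) eq))
  = s≤s z≤n , ≤-trans (s≤s (proj₂ (inRange (suc k) j' eq))) (≤-trans (n≤1+n _) (≤-reflexive (sym (length-shift1 δ))))
MatesInRange-shift1 δ inRange (suc (suc k)) j h | inj₂ refl with trans (sym h) (at-shift1-last δ)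
... | refl = s≤s z≤n , ≤-trans (s≤s z≤n) (≤-reflexive (sym (length-shift1 δ)))

MatesInRange-shiftN : ∀ m δ → MatesInRange δ → MatesInRange (shiftN m δ)
MatesInRange-shiftN zero δ inRange = inRange
MatesInRange-shiftN (suc m) δ inRange = MatesInRange-shift1 (shiftN m δ) (MatesInRange-shiftN m δ inRange)

-- since the shift adds 2n+1 to the length, it preserves the comparisons in a reduced word
inv-shift1-< : ∀ δ δ' → MatesInRange δ → MatesInRange δ' → length δ' ≡ length δ →
  inv δ < inv δ' → inv (shift1 δ) < inv (shift1 δ')
inv-shift1-< δ δ' inRange inRange' len lt =
  subst₂ _<_ (sym (inv-shift1 δ inRange)) (sym (trans (inv-shift1 δ' inRange') (cong (λ n → suc n + (inv δ' + n)) len)))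
    (+-monoʳ-< (suc (length δ)) (+-monoˡ-< (length δ) lt))

inv-unshift1-< : ∀ δ δ' → MatesInRange δ → MatesInRange δ' → length δ' ≡ length δ →
  inv (shift1 δ) < inv (shift1 δ') → inv δ < inv δ'
inv-unshift1-< δ δ' inRange inRange' len lt =
  +-cancelʳ-< (length δ) (inv δ) (inv δ') (+-cancelˡ-< (suc (length δ)) (inv δ + length δ) (inv δ' + length δ)
    (subst₂ _<_ (inv-shift1 δ inRange) (trans (inv-shift1 δ' inRange') (cong (λ n → suc n + (inv δ' + n)) len)) lt))

red-shift1 : ∀ p q δ w → MatesInRange δ → RedRev p q δ w → RedRev (suc p) (suc q) (shift1 δ) (map suc w)
red-shift1 p q δ [] _ δ≡γ = trans (cong shift1 δ≡γ) (sym (gpq-shift1 p q))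
red-shift1 p q δ (x ∷ w) inRange (δ' , st , lt , rest) with star-step x δ δ' st
... | 1≤x , x<n , _ = shift1 δ' , trans (star-shift1 x δ 1≤x x<n) (cong (mmap shift1) st) ,
    inv-shift1-< δ δ' inRange inRange' (length-star x δ δ' st) lt , red-shift1 p q δ' w inRange' rest
  where
  inRange' = MatesInRange-star x δ δ' inRange st

mmap-shift1-just : ∀ (m : Maybe Raw) Δ → mmap shift1 m ≡ just Δ → Σ Raw λ δ' → (m ≡ just δ') × (Δ ≡ shift1 δ')
mmap-shift1-just (just δ') Δ refl = δ' , refl , refl

-- Letter 1 and letter n+1 would have to lengthen ι(γ^{+1}) (impossible by
-- the boundary bounds, or the letter acts on a matched boundary position);
-- every other letter x+1 acts on γ^{+1} as x acts on γ.
red-unshift1 : ∀ p q δ w → MatesInRange δ → RedRev (suc p) (suc q) (shift1 δ) w →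
  Σ (List ℕ) λ w' → (w ≡ map suc w') × RedRev p q δ w'
red-unshift1 p q δ [] _ Δ≡γ = [] , refl , shift1-injective δ (gpq p q) (trans Δ≡γ (gpq-shift1 p q))
red-unshift1 p q δ (x ∷ w) inRange (Δ' , st , lt , rest) with star-step x (shift1 δ) Δ' st
red-unshift1 p q δ (suc zero ∷ w) inRange (Δ' , st , lt , rest) | _ , _ , byMatch () _ _
red-unshift1 p q [] (suc zero ∷ w) inRange (Δ' , () , lt , rest) | _ , _ , byConj refl
red-unshift1 p q (e ∷ δ) (suc zero ∷ w) inRange (Δ' , st , lt , rest) | _ , _ , byConj refl =
  ⊥-elim (≤⇒≯ (conj-first-not-longer (e ∷ δ) (length δ) refl inRange) lt)
red-unshift1 p q δ (suc (suc x) ∷ w) inRange (Δ' , st , lt , rest) | _ , x<N , _ with <-cmp (suc x) (length δ)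
... | tri< x<n _ _ with mmap-shift1-just (star (suc x) δ) Δ' (trans (sym (star-shift1 (suc x) δ (s≤s z≤n) x<n)) st)
...   | δ' , st' , refl with MatesInRange-star (suc x) δ δ' inRange st'
...     | inRange' with red-unshift1 p q δ' w inRange' rest
...       | w' , refl , red' =
  suc x ∷ w' , refl , (δ' , st' , inv-unshift1-< δ δ' inRange inRange' (length-star (suc x) δ δ' st') lt , red')
red-unshift1 p q δ (suc (suc x) ∷ w) inRange (Δ' , st , lt , rest) | _ , _ , byConj refl | tri≈ _ x≡n _ =
  ⊥-elim (≤⇒≯ (subst (λ z → inv (conj (suc z) (shift1 δ)) ≤ inv (shift1 δ)) (sym x≡n) (conj-last-not-longer δ x (sym x≡n) inRange)) lt)
red-unshift1 p q δ (suc (suc x) ∷ w) inRange (Δ' , st , lt , rest) | _ , _ , byMatch _ sign-at-end _ | tri≈ _ x≡n _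
  with () ← trans (sym sign-at-end) (subst (λ z → at (shift1 δ) (suc (suc z)) ≡ just (mate 1)) (sym x≡n) (at-shift1-last δ))
red-unshift1 p q δ (suc (suc x) ∷ w) inRange (Δ' , st , lt , rest) | _ , x<N , _ | tri> _ _ n<x =
  ⊥-elim (≤⇒≯ (≤-pred (≤-pred (subst (suc (suc x) <_) (length-shift1 δ) x<N))) n<x)

shiftN-+ : ∀ m p q δ → RedRev (p + suc m) (q + suc m) (shiftN (suc m) δ) ≡ RedRev (suc (p + m)) (suc (q + m)) (shift1 (shiftN m δ))
shiftN-+ m p q δ = cong₂ (λ a b → RedRev a b (shift1 (shiftN m δ))) (+-suc p m) (+-suc q m)

red-shiftN : ∀ m p q δ w → MatesInRange δ → RedRev p q δ w → RedRev (p + m) (q + m) (shiftN m δ) (map (m +_) w)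
red-shiftN zero p q δ w _ red =
  subst₂ (λ a b → RedRev a b δ (map (0 +_) w)) (sym (+-identityʳ p)) (sym (+-identityʳ q)) (subst (RedRev p q δ) (sym (map-id w)) red)
red-shiftN (suc m) p q δ w inRange red =
  subst (λ P → P (map (suc m +_) w)) (sym (shiftN-+ m p q δ))
    (subst (RedRev (suc (p + m)) (suc (q + m)) (shift1 (shiftN m δ))) (sym (map-∘ w))
      (red-shift1 (p + m) (q + m) (shiftN m δ) (map (m +_) w) (MatesInRange-shiftN m δ inRange) (red-shiftN m p q δ w inRange red)))

red-unshiftN : ∀ m p q δ w → MatesInRange δ → RedRev (p + m) (q + m) (shiftN m δ) w →
  Σ (List ℕ) λ w' → (w ≡ map (m +_) w') × RedRev p q δ w'
red-unshiftN zero p q δ w _ red = w , sym (map-id w) , subst₂ (λ a b → RedRev a b δ w) (+-identityʳ p) (+-identityʳ q) red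
red-unshiftN (suc m) p q δ w inRange red
  with red-unshift1 (p + m) (q + m) (shiftN m δ) w (MatesInRange-shiftN m δ inRange) (subst (λ P → P w) (shiftN-+ m p q δ) red)
... | w₁ , refl , red₁ with red-unshiftN m p q δ w₁ inRange red₁
... | w' , refl , red' = w' , sym (map-∘ w') , red'

-- 𝓡(γ) is finite: a bounded backwards search enumerates its reversed words

_≟ₑ_ : DecidableEquality Entry
sgn s ≟ₑ sgn t with s ≟𝔹 t
... | yes refl = yes refl
... | no s≢t = no (λ { refl → s≢t refl })
sgn _ ≟ₑ mate _ = no (λ ())
mate _ ≟ₑ sgn _ = no (λ ())
mate i ≟ₑ mate j with i ≟ j
... | yes refl = yes refl
... | no i≢j = no (λ { refl → i≢j refl })

atBase : ℕ → ℕ → Raw → List (List ℕ)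
atBase p q δ with ≡-dec _≟ₑ_ δ (gpq p q)
... | yes _ = [] ∷ []
... | no _ = []

mutual
  revWords : ℕ → ℕ → ℕ → Raw → List (List ℕ)
  revWords p q zero δ = atBase p q δ
  revWords p q (suc f) δ = atBase p q δ ++ concatMap (λ x → viaLetter p q f δ x (star x δ)) (upTo (length δ))

  viaLetter : ℕ → ℕ → ℕ → Raw → ℕ → Maybe Raw → List (List ℕ)
  viaLetter p q f δ x nothing = []
  viaLetter p q f δ x (just δ') with inv δ <? inv δ'
  ... | yes _ = map (x ∷_) (revWords p q f δ')
  ... | no _ = []

atBase-sound : ∀ p q δ w → w ∈ atBase p q δ → RedRev p q δ w
atBase-sound p q δ w h with ≡-dec _≟ₑ_ δ (gpq p q)
atBase-sound p q δ .[] (here refl) | yes δ≡γ = δ≡γ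

atBase-complete : ∀ p q δ → δ ≡ gpq p q → [] ∈ atBase p q δ
atBase-complete p q δ δ≡γ with ≡-dec _≟ₑ_ δ (gpq p q)
... | yes _ = here refl
... | no δ≢γ = ⊥-elim (δ≢γ δ≡γ)

mutual
  revWords-sound : ∀ p q f δ w → w ∈ revWords p q f δ → RedRev p q δ w
  revWords-sound p q zero δ w h = atBase-sound p q δ w h
  revWords-sound p q (suc f) δ w h with ∈-++⁻ (atBase p q δ) h
  ... | inj₁ h' = atBase-sound p q δ w h'
  ... | inj₂ h' with ∈-concat⁻′ (map (λ x → viaLetter p q f δ x (star x δ)) (upTo (length δ))) h'
  ...   | ws , w∈ws , ws∈ with ∈-map⁻ (λ x → viaLetter p q f δ x (star x δ)) ws∈
  ...     | x , _ , refl = viaLetter-sound p q f δ x (star x δ) refl w w∈ws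

  viaLetter-sound : ∀ p q f δ x m → star x δ ≡ m → ∀ w → w ∈ viaLetter p q f δ x m → RedRev p q δ w
  viaLetter-sound p q f δ x (just δ') st w h with inv δ <? inv δ'
  ... | yes lt with ∈-map⁻ (x ∷_) h
  ...   | w' , h' , refl = δ' , st , lt , revWords-sound p q f δ' w' h'

-- each letter of a reduced word increases ℓ, so its length is at most ℓ(ι(γ_{p,q}))
length-bound : ∀ p q δ w → RedRev p q δ w → length w + inv δ ≤ inv (gpq p q)
length-bound p q δ [] refl = ≤-refl
length-bound p q δ (x ∷ w) (δ' , _ , lt , rest) =
  ≤-trans (≤-reflexive (sym (+-suc (length w) (inv δ)))) (≤-trans (+-monoʳ-≤ (length w) lt) (length-bound p q δ' w rest))

revWords-complete : ∀ p q f δ w → RedRev p q δ w → length w ≤ f → w ∈ revWords p q f δ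
revWords-complete p q zero δ [] red _ = atBase-complete p q δ red
revWords-complete p q (suc f) δ [] red _ = ∈-++⁺ˡ (atBase-complete p q δ red)
revWords-complete p q (suc f) δ (x ∷ w) (δ' , st , lt , rest) (s≤s |w|≤f) =
  ∈-++⁺ʳ (atBase p q δ) (∈-concat⁺′ viaX (∈-map⁺ (λ y → viaLetter p q f δ y (star y δ)) (∈-upTo⁺ (proj₁ (proj₂ (star-step x δ δ' st))))))
  where
  viaX : (x ∷ w) ∈ viaLetter p q f δ x (star x δ)
  viaX rewrite st with inv δ <? inv δ'
  ... | yes _ = ∈-map⁺ (x ∷_) (revWords-complete p q f δ' w rest |w|≤f)
  ... | no ¬lt = ⊥-elim (¬lt lt)

_≟ʷ_ : DecidableEquality (List ℕ)
_≟ʷ_ = ≡-dec _≟_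

reducedWords : ℕ → ℕ → Raw → List (List ℕ)
reducedWords p q δ = deduplicate _≟ʷ_ (map reverse (revWords p q (inv (gpq p q)) δ))

reducedWords-enumerates : ∀ p q δ → Enumerates (reducedWords p q δ) (Red p q δ)
reducedWords-enumerates p q δ = DecUnique.deduplicate-! _≟ʷ_ candidates , λ a → mk⇔ (sound a) (complete a)
  where
  candidates = map reverse (revWords p q (inv (gpq p q)) δ)
  sound : ∀ a → a ∈ reducedWords p q δ → Red p q δ a
  sound a h with ∈-map⁻ reverse (∈-deduplicate⁻ (setoid (List ℕ)) _≟ʷ_ candidates h)
  ... | w , w∈ , refl = subst (RedRev p q δ) (sym (reverse-involutive w)) (revWords-sound p q (inv (gpq p q)) δ w w∈)
  complete : ∀ a → Red p q δ a → a ∈ reducedWords p q δ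
  complete a red = ∈-deduplicate⁺ (setoid (List ℕ)) _≟ʷ_ (λ z≡y x≡y → trans x≡y (sym z≡y))
    (subst (_∈ candidates) (reverse-involutive a)
      (∈-map⁺ reverse (revWords-complete p q (inv (gpq p q)) δ (reverse a) red
        (≤-trans (m≤m+n _ _) (length-bound p q δ (reverse a) red)))))

staircase : ℕ → List ℕ
staircase k = map suc (upTo k)

length-staircase : ∀ k → length (staircase k) ≡ k
length-staircase k = trans (length-map suc (upTo k)) (length-upTo k)

Comp-length : ∀ a b → Comp a b → length a ≡ length b
Comp-length [] [] _ = refl
Comp-length (_ ∷ a) (_ ∷ b) (_ , _ , _ , rest) = cong suc (Comp-length a b rest)

Comp-consecutive : ∀ s (g : ℕ → ℕ) m (a : List ℕ) → (∀ i → g i ≡ suc (s + i)) → s + length a ≤ m →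
  Comp (map (m +_) a) (applyUpTo g (length a))
Comp-consecutive s g m [] _ _ = tt
Comp-consecutive s g m (x ∷ a) g≡ bound = 1≤g0 , g0≤m+x , step a , Comp-consecutive (suc s) (g ∘ suc) m a g≡' bound'
  where
  1≤g0 : 1 ≤ g 0
  1≤g0 = subst (1 ≤_) (sym (g≡ 0)) (s≤s z≤n)
  g0≤m+x : g 0 ≤ m + x
  g0≤m+x = ≤-trans (≤-reflexive (trans (g≡ 0) (sym (+-suc s 0)))) (≤-trans (+-monoʳ-≤ s (s≤s z≤n)) (≤-trans bound (m≤m+n m x)))
  g≡' : ∀ i → g (suc i) ≡ suc (suc s + i)
  g≡' i = trans (g≡ (suc i)) (cong suc (+-suc s i))
  bound' : suc s + length a ≤ m
  bound' = ≤-trans (≤-reflexive (sym (+-suc s (length a)))) bound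
  g0<g1 : g 0 < g 1
  g0<g1 = subst₂ _<_ (sym (g≡ 0)) (sym (g≡ 1)) (s≤s (+-monoʳ-< s (s≤s z≤n)))
  step : ∀ a → Step (m + x) (g 0) (map (m +_) a) (applyUpTo (g ∘ suc) (length a))
  step [] = tt
  step (_ ∷ _) = <⇒≤ g0<g1 , λ _ → g0<g1

Comp-staircase : ∀ m (a : List ℕ) → length a ≤ m → Comp (map (m +_) a) (staircase (length a))
Comp-staircase m a |a|≤m = subst (Comp (map (m +_) a)) (sym (map-applyUpTo id suc (length a)))
  (Comp-consecutive 0 suc m a (λ _ → refl) |a|≤m)

ofLength : ℕ → List (List ℕ) → List (List ℕ)
ofLength k = filter (λ a → length a ≟ k)

shifted-words-of-length : ∀ p q δ → MatesInRange δ → ∀ k m → k ≤ m → ∀ a →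
  a ∈ map (map (m +_)) (ofLength k (reducedWords p q δ)) → Red (p + m) (q + m) (shiftN m δ) a × Comp a (staircase k)
shifted-words-of-length p q δ inRange k m k≤m a h with ∈-map⁻ (map (m +_)) h
... | a' , a'∈ , refl with ∈-filter⁻ (λ b → length b ≟ k) a'∈
... | a'∈𝓡 , refl = subst (RedRev (p + m) (q + m) (shiftN m δ)) (reverse-map (m +_) a')
                         (red-shiftN m p q δ (reverse a') inRange (Equivalence.to (proj₂ (reducedWords-enumerates p q δ) a') a'∈𝓡)) ,
                    Comp-staircase m a' k≤m

words-of-length-shifted : ∀ p q δ → MatesInRange δ → ∀ k m → ∀ a →
  Red (p + m) (q + m) (shiftN m δ) a × Comp a (staircase k) → a ∈ map (map (m +_)) (ofLength k (reducedWords p q δ))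
words-of-length-shifted p q δ inRange k m a (red , comp) with red-unshiftN m p q δ (reverse a) inRange red
... | w' , rev≡ , red' = subst (_∈ map (map (m +_)) (ofLength k (reducedWords p q δ))) (sym a≡)
      (∈-map⁺ (map (m +_)) (∈-filter⁺ (λ b → length b ≟ k) a'∈𝓡 |a'|≡k))
  where
  a≡ : a ≡ map (m +_) (reverse w')
  a≡ = trans (sym (reverse-involutive a)) (trans (cong reverse rev≡) (sym (reverse-map (m +_) w')))
  a'∈𝓡 : reverse w' ∈ reducedWords p q δ
  a'∈𝓡 = Equivalence.from (proj₂ (reducedWords-enumerates p q δ) (reverse w'))
           (subst (RedRev p q δ) (sym (reverse-involutive w')) red')
  |a'|≡k : length (reverse w') ≡ k
  |a'|≡k = trans (sym (length-map (m +_) (reverse w')))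
             (trans (cong length (sym a≡)) (trans (Comp-length a (staircase k) comp) (length-staircase k)))

coefficient-staircase : ∀ p q δ → MatesInRange δ → ∀ k → CoefF p q δ (staircase k) (length (ofLength k (reducedWords p q δ)))
coefficient-staircase p q δ inRange k = k , λ m k≤m →
  map (map (m +_)) words ,
  (Unique.map⁺ (map-injective (+-cancelˡ-≡ m _ _)) (Unique.filter⁺ (λ a → length a ≟ k) (proj₁ (reducedWords-enumerates p q δ))) ,
   λ a → mk⇔ (shifted-words-of-length p q δ inRange k m k≤m a) (words-of-length-shifted p q δ inRange k m a)) ,
  length-map (map (m +_)) words
  where
  words = ofLength k (reducedWords p q δ)

-- under the degree hypothesis every reduced word has length ℓ: its length
-- k gives a nonzero coefficient of x₁⋯x_k
reduced-words-have-degree-length : ∀ p q δ ℓ → MatesInRange δ → FDegree p q δ ℓ →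
  ∀ a → a ∈ reducedWords p q δ → length a ≡ ℓ
reduced-words-have-degree-length p q δ ℓ inRange (_ , homogeneous) a a∈𝓡 =
  trans (sym (length-staircase (length a)))
    (homogeneous (staircase (length a)) _ (coefficient-staircase p q δ inRange (length a)) (nonempty (∈-filter⁺ (λ b → length b ≟ length a) a∈𝓡 refl)))
  where
  nonempty : ∀ {x : List ℕ} {xs} → x ∈ xs → length xs ≢ 0
  nonempty {xs = _ ∷ _} _ ()

mainTheorem12 : (p q : ℕ) (γ : Clan p q) (ℓ : ℕ) → FDegree p q (proj₁ γ) ℓ →
    Σ (List (List ℕ)) λ L → Enumerates L (Red p q (proj₁ γ))
    × CoefF p q (proj₁ γ) (map suc (upTo ℓ)) (length L)
mainTheorem12 p q (δ , (_ , involution , _)) ℓ degree =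
  reducedWords p q δ , reducedWords-enumerates p q δ ,
  subst (CoefF p q δ (staircase ℓ)) (cong length allOfLengthℓ) (coefficient-staircase p q δ inRange ℓ)
  where
  inRange : MatesInRange δ
  inRange k j h = at-range δ j (proj₂ (involution k j h))
  allOfLengthℓ : ofLength ℓ (reducedWords p q δ) ≡ reducedWords p q δ
  allOfLengthℓ = filter-all (λ a → length a ≟ ℓ) (All.tabulate (λ {a} → reduced-words-have-degree-length p q δ ℓ inRange degree a))
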